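{- For every non-negative integer $n$ and every integer $s$, \[ \sum_{k = 1}^{\lceil n/2 \rceil} \binom {n}{2k-1} 4^k F_{2k + s} = \begin{cases} F_{3n + 1 + s} - 5^{n/2}F_{s+1}, & \text{$n$ even;}\\ F_{3n + 1 + s} + 5^{(n-1)/2}L_{s+1}, & \text{$n$ odd,} \end{cases} \qquad \sum_{k = 1}^{\lceil n/2 \rceil} \binom {n}{2k-1} 4^k L_{2k + s} = \begin{cases} L_{3n + 1 + s} - 5^{n/2} L_{s+1}, & \text{$n$ even;}\\ L_{3n + 1 + s} + 5^{(n+1)/2}F_{s+1}, & \text{$n$ odd.} \end{cases} \]
   Context: The Fibonacci numbers $F_j$ and Lucas numbers $L_j$ are defined for all integers $j$ by $F_0=0$, $F_1=1$, $L_0=2$, $L_1=1$, $F_j=F_{j-1}+F_{j-2}$, $L_j=L_{j-1}+L_{j-2}$, with $F_{ -j}=(-1)^{j-1}F_j$ and $L_{ -j}=(-1)^jL_j$. An empty sum equals $0$. -}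

module Defs where

open import Data.Nat as ℕ using (ℕ; zero; suc)
open import Data.Nat.Combinatorics using (_C_)
open import Data.Integer using (ℤ; +_; -[1+_]; _+_; _-_; _*_; -_; _^_)

fibℕ : ℕ → ℤ
fibℕ 0 = + 0
fibℕ 1 = + 1
fibℕ (suc (suc n)) = fibℕ (suc n) + fibℕ n

lucℕ : ℕ → ℤ
lucℕ 0 = + 2
lucℕ 1 = + 1
lucℕ (suc (suc n)) = lucℕ (suc n) + lucℕ n

sgn : ℕ → ℤ
sgn zero = + 1
sgn (suc j) = - sgn j

-- F_{-j} = (-1)^{j-1} F_j , L_{-j} = (-1)^j L_j
F : ℤ → ℤ
F (+ n) = fibℕ n
F -[1+ j ] = sgn j * fibℕ (suc j)

L : ℤ → ℤ
L (+ n) = lucℕ n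
L -[1+ j ] = sgn (suc j) * lucℕ (suc j)

ceilHalf : ℕ → ℕ
ceilHalf n = n ℕ.∸ (n ℕ./ 2)

sumFrom1 : ℕ → (ℕ → ℤ) → ℤ
sumFrom1 zero f = + 0
sumFrom1 (suc m) f = sumFrom1 m f + f (suc m)

-- Write g_j = G_{j+1+s} with G = F or L; g satisfies g_{j+2} = g_{j+1} + g_j. By Pascal's rule
-- the binomial transform Σ_j C(n,j) c^j g_j is the n-th iterate of g ↦ (g_j + c g_{j+1})_j,
-- evaluated at 0. On the Binet components φ^j, ψ^j this operator multiplies by 1 + cφ, 1 + cψ:
-- for c = 2 these are φ³, ψ³, so the transform is g_{3n}; for c = −2 they are −√5, √5, so two
-- steps multiply by 5. As 2^j − (−2)^j vanishes for even j and equals 4^k for j = 2k − 1, the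
-- sum in the theorem is the difference of these two transforms. The leftover single step for
-- odd n maps F to −L and L to −5F.
module Submission where

open import Defs
open import Data.Nat as ℕ using (ℕ; zero; suc)
open import Data.Nat.Combinatorics using (_C_; nCk+nC[k+1]≡[n+1]C[k+1]; k>n⇒nCk≡0)
import Data.Nat.Properties as ℕₚ
open import Data.Nat.DivMod using (m/n≡1+[m∸n]/n; m/n≤m)
open import Data.Integer using (ℤ; +_; -[1+_]; _+_; _-_; _*_; -_; _^_) renaming (suc to sucℤ)
import Data.Integer.Properties as ℤₚ
open import Data.Integer.Tactic.RingSolver using (solve-∀)
open import Algebra.Properties.AbelianGroup ℤₚ.+-0-abelianGroup using (∙-cancelˡ)
open import Algebra.Properties.CommutativeSemigroup ℤₚ.+-commutativeSemigroup using (interchange)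
open import Data.Product using (_×_; _,_; proj₁)
open import Relation.Binary.PropositionalEquality using (_≡_; refl; sym; trans; cong; cong₂; module ≡-Reasoning)
open ≡-Reasoning

record FibLikeℤ (G : ℤ → ℤ) : Set where
  constructor fibLikeℤ
  field recurrence : ∀ t → G (sucℤ (sucℤ t)) ≡ G (sucℤ t) + G t

F-fibLike : FibLikeℤ F
F-fibLike = fibLikeℤ λ
  { (+ n) → refl
  ; -[1+ 0 ] → refl
  ; -[1+ 1 ] → refl
  ; -[1+ suc (suc k) ] → recurrence (sgn k) (fibℕ (suc k)) (fibℕ (suc (suc k)))
  }
  where
  recurrence : ∀ σ a b → σ * a ≡ - σ * b + - - σ * (b + a)
  recurrence = solve-∀

L-fibLike : FibLikeℤ L
L-fibLike = fibLikeℤ λ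
  { (+ n) → refl
  ; -[1+ 0 ] → refl
  ; -[1+ 1 ] → refl
  ; -[1+ suc (suc k) ] → recurrence (sgn k) (lucℕ (suc k)) (lucℕ (suc (suc k)))
  }
  where
  recurrence : ∀ σ a b → - σ * a ≡ - - σ * b + - - - σ * (b + a)
  recurrence = solve-∀

FibLikeℤ-+ : ∀ {G H} → FibLikeℤ G → FibLikeℤ H → FibLikeℤ (λ t → G t + H t)
FibLikeℤ-+ {G} {H} (fibLikeℤ G-rec) (fibLikeℤ H-rec) = fibLikeℤ λ t →
  trans (cong₂ _+_ (G-rec t) (H-rec t)) (interchange (G (sucℤ t)) (G t) (H (sucℤ t)) (H t))

FibLikeℤ-* : ∀ c {G} → FibLikeℤ G → FibLikeℤ (λ t → c * G t)
FibLikeℤ-* c (fibLikeℤ G-rec) = fibLikeℤ λ t → trans (cong (c *_) (G-rec t)) (ℤₚ.*-distribˡ-+ c _ _)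

FibLikeℤ-neg : ∀ {G} → FibLikeℤ G → FibLikeℤ (λ t → - G t)
FibLikeℤ-neg {G} (fibLikeℤ G-rec) = fibLikeℤ λ t →
  trans (cong -_ (G-rec t)) (ℤₚ.neg-distrib-+ (G (sucℤ t)) (G t))

FibLikeℤ-∘suc : ∀ {G} → FibLikeℤ G → FibLikeℤ (λ t → G (sucℤ t))
FibLikeℤ-∘suc (fibLikeℤ G-rec) = fibLikeℤ λ t → G-rec (sucℤ t)

FibLikeℤ-unique : ∀ {G H} → FibLikeℤ G → FibLikeℤ H →
                  G (+ 0) ≡ H (+ 0) → G (+ 1) ≡ H (+ 1) → ∀ t → G t ≡ H t
FibLikeℤ-unique {G} {H} (fibLikeℤ G-rec) (fibLikeℤ H-rec) G₀≡H₀ G₁≡H₁ t = proj₁ (agree t)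
  where
  Agree : ℤ → Set
  Agree t = G t ≡ H t × G (sucℤ t) ≡ H (sucℤ t)

  forward : ∀ {t} → Agree t → Agree (sucℤ t)
  forward {t} (e₀ , e₁) = e₁ , trans (G-rec t) (trans (cong₂ _+_ e₁ e₀) (sym (H-rec t)))

  backward : ∀ {t} → Agree (sucℤ t) → Agree t
  backward {t} (e₁ , e₂) = ∙-cancelˡ (H (sucℤ t)) (G t) (H t) sums-agree , e₁
    where
    sums-agree : H (sucℤ t) + G t ≡ H (sucℤ t) + H t
    sums-agree = trans (cong (_+ G t) (sym e₁)) (trans (sym (G-rec t)) (trans e₂ (H-rec t)))

  agree⁺ : ∀ n → Agree (+ n)
  agree⁺ zero = G₀≡H₀ , G₁≡H₁
  agree⁺ (suc n) = forward (agree⁺ n)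

  agree⁻ : ∀ j → Agree -[1+ j ]
  agree⁻ zero = backward (agree⁺ 0)
  agree⁻ (suc j) = backward (agree⁻ j)

  agree : ∀ t → Agree t
  agree (+ n) = agree⁺ n
  agree -[1+ j ] = agree⁻ j

F-Δ : ∀ t → F t + - + 2 * F (sucℤ t) ≡ - L t
F-Δ = FibLikeℤ-unique (FibLikeℤ-+ F-fibLike (FibLikeℤ-* (- + 2) (FibLikeℤ-∘suc F-fibLike)))
                      (FibLikeℤ-neg L-fibLike) refl refl

L-Δ : ∀ t → L t + - + 2 * L (sucℤ t) ≡ - (+ 5 * F t)
L-Δ = FibLikeℤ-unique (FibLikeℤ-+ L-fibLike (FibLikeℤ-* (- + 2) (FibLikeℤ-∘suc L-fibLike)))
                      (FibLikeℤ-neg (FibLikeℤ-* (+ 5) F-fibLike)) refl refl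

record FibLike (g : ℕ → ℤ) : Set where
  constructor fibLike
  field recurrence : ∀ j → g (2 ℕ.+ j) ≡ g (1 ℕ.+ j) + g j

FibLikeℤ⇒FibLike : ∀ {G} → FibLikeℤ G → ∀ s → FibLike (λ j → G (+ j + s))
FibLikeℤ⇒FibLike {G} (fibLikeℤ G-rec) s = fibLike λ j → begin
    G (+ (2 ℕ.+ j) + s)
  ≡⟨ cong G (trans (ℤₚ.suc-+ (suc j) s) (cong sucℤ (ℤₚ.suc-+ j s))) ⟩
    G (sucℤ (sucℤ (+ j + s)))
  ≡⟨ G-rec (+ j + s) ⟩
    G (sucℤ (+ j + s)) + G (+ j + s)
  ≡⟨ cong (λ t → G t + G (+ j + s)) (sym (ℤₚ.suc-+ j s)) ⟩
    G (+ (1 ℕ.+ j) + s) + G (+ j + s)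
  ∎

FibLike-∘suc : ∀ {g} → FibLike g → FibLike (λ j → g (suc j))
FibLike-∘suc (fibLike g-rec) = fibLike λ j → g-rec (suc j)

FibLike-2-step : ∀ {g} → FibLike g → ∀ j → g j + + 2 * g (suc j) ≡ g (3 ℕ.+ j)
FibLike-2-step {g} (fibLike g-rec) j =
  trans (expand (g j) (g (suc j))) (sym (trans (g-rec (suc j)) (cong (_+ g (suc j)) (g-rec j))))
  where
  expand : ∀ a b → a + + 2 * b ≡ (b + a) + b
  expand = solve-∀

-- On Fibonacci-like sequences Δ acts as multiplication by 1 − 2φ = −√5.
Δ : (ℕ → ℤ) → ℕ → ℤ
Δ g j = g j + - + 2 * g (suc j)

FibLike-Δ : ∀ {g} → FibLike g → FibLike (Δ g)
FibLike-Δ {g} (fibLike g-rec) = fibLike λ j → begin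
    g (2 ℕ.+ j) + - + 2 * g (3 ℕ.+ j)
  ≡⟨ cong₂ (λ x y → x + - + 2 * y) (g-rec j) (trans (g-rec (suc j)) (cong (_+ g (suc j)) (g-rec j))) ⟩
    (g (suc j) + g j) + - + 2 * ((g (suc j) + g j) + g (suc j))
  ≡⟨ regroup (g j) (g (suc j)) ⟩
    (g (suc j) + - + 2 * (g (suc j) + g j)) + Δ g j
  ≡⟨ cong (λ x → (g (suc j) + - + 2 * x) + Δ g j) (sym (g-rec j)) ⟩
    Δ g (suc j) + Δ g j
  ∎
  where
  regroup : ∀ a b → (b + a) + - + 2 * ((b + a) + b) ≡ ((b + - + 2 * (b + a)) + (a + - + 2 * b))
  regroup = solve-∀

Δ-Δ : ∀ {g} → FibLike g → ∀ j → Δ (Δ g) j ≡ + 5 * g j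
Δ-Δ {g} (fibLike g-rec) j =
  trans (cong (λ x → Δ g j + - + 2 * (g (suc j) + - + 2 * x)) (g-rec j)) (expand (g j) (g (suc j)))
  where
  expand : ∀ a b → (a + - + 2 * b) + - + 2 * (b + - + 2 * (b + a)) ≡ + 5 * a
  expand = solve-∀

sumBelow : ℕ → (ℕ → ℤ) → ℤ
sumBelow zero f = + 0
sumBelow (suc N) f = sumBelow N f + f N

sumBelow-cong : ∀ N {f g : ℕ → ℤ} → (∀ j → f j ≡ g j) → sumBelow N f ≡ sumBelow N g
sumBelow-cong zero f≗g = refl
sumBelow-cong (suc N) f≗g = cong₂ _+_ (sumBelow-cong N f≗g) (f≗g N)

sumBelow-suc-0 : ∀ N (f : ℕ → ℤ) → f N ≡ + 0 → sumBelow (suc N) f ≡ sumBelow N f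
sumBelow-suc-0 N f fN≡0 = trans (cong (λ x → sumBelow N f + x) fN≡0) (ℤₚ.+-identityʳ (sumBelow N f))

sumBelow-+ : ∀ N (f g : ℕ → ℤ) → sumBelow N (λ j → f j + g j) ≡ sumBelow N f + sumBelow N g
sumBelow-+ zero f g = refl
sumBelow-+ (suc N) f g =
  trans (cong (_+ (f N + g N)) (sumBelow-+ N f g)) (interchange (sumBelow N f) (sumBelow N g) (f N) (g N))

sumBelow-- : ∀ N (f g : ℕ → ℤ) → sumBelow N (λ j → f j - g j) ≡ sumBelow N f - sumBelow N g
sumBelow-- zero f g = refl
sumBelow-- (suc N) f g =
  trans (cong (_+ (f N - g N)) (sumBelow-- N f g)) (regroup (sumBelow N f) (sumBelow N g) (f N) (g N))
  where
  regroup : ∀ a b c d → (a - b) + (c - d) ≡ (a + c) - (b + d)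
  regroup = solve-∀

sumFrom1≡sumBelow-2* : ∀ K {f h} → (∀ k → h (2 ℕ.* k) ≡ + 0) → (∀ k → f (suc k) ≡ h (suc (2 ℕ.* k))) →
                       sumFrom1 K f ≡ sumBelow (2 ℕ.* K) h
sumFrom1≡sumBelow-2* zero h-even f-odd = refl
sumFrom1≡sumBelow-2* (suc K) {f} {h} h-even f-odd = begin
    sumFrom1 K f + f (suc K)
  ≡⟨ cong₂ _+_ (sumFrom1≡sumBelow-2* K h-even f-odd) (f-odd K) ⟩
    sumBelow (2 ℕ.* K) h + h (suc (2 ℕ.* K))
  ≡⟨ cong (_+ h (suc (2 ℕ.* K))) (sym (sumBelow-suc-0 (2 ℕ.* K) h (h-even K))) ⟩
    sumBelow (suc (suc (2 ℕ.* K))) h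
  ≡⟨ cong (λ N → sumBelow N h) (sym (ℕₚ.*-suc 2 K)) ⟩
    sumBelow (2 ℕ.* suc K) h
  ∎

binomialSum : ℕ → (ℕ → ℤ) → ℤ
binomialSum n f = sumBelow (suc n) (λ j → + (n C j) * f j)

binomialSum-cong : ∀ n {f g : ℕ → ℤ} → (∀ j → f j ≡ g j) → binomialSum n f ≡ binomialSum n g
binomialSum-cong n f≗g = sumBelow-cong (suc n) (λ j → cong (+ (n C j) *_) (f≗g j))

binomialSum-zero : ∀ (f : ℕ → ℤ) → binomialSum 0 f ≡ f 0
binomialSum-zero f = trans (ℤₚ.+-identityˡ (+ 1 * f 0)) (ℤₚ.*-identityˡ (f 0))

sumBelow-pascal : ∀ n N (f : ℕ → ℤ) →
  sumBelow (suc N) (λ j → + (suc n C j) * f j)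
    ≡ sumBelow N (λ j → + (n C j) * f (suc j)) + sumBelow (suc N) (λ j → + (n C j) * f j)
sumBelow-pascal n zero f = cong (λ x → + 0 + x) (sym (ℤₚ.+-identityˡ (+ (n C 0) * f 0)))
sumBelow-pascal n (suc N) f = begin
    sumBelow (suc N) (λ j → + (suc n C j) * f j) + + (suc n C suc N) * f (suc N)
  ≡⟨ cong₂ (λ u c → u + + c * f (suc N)) (sumBelow-pascal n N f) (sym (nCk+nC[k+1]≡[n+1]C[k+1] n N)) ⟩
    (A + B) + (+ (n C N) + + (n C suc N)) * f (suc N)
  ≡⟨ regroup A B (+ (n C N)) (+ (n C suc N)) (f (suc N)) ⟩
    (A + + (n C N) * f (suc N)) + (B + + (n C suc N) * f (suc N))
  ∎
  where
  A B : ℤ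
  A = sumBelow N (λ j → + (n C j) * f (suc j))
  B = sumBelow (suc N) (λ j → + (n C j) * f j)
  regroup : ∀ a b c d x → (a + b) + (c + d) * x ≡ (a + c * x) + (b + d * x)
  regroup = solve-∀

binomialSum-suc : ∀ n (f : ℕ → ℤ) → binomialSum (suc n) f ≡ binomialSum n (λ j → f j + f (suc j))
binomialSum-suc n f = begin
    binomialSum (suc n) f
  ≡⟨ sumBelow-pascal n (suc n) f ⟩
    shifted + (binomialSum n f + + (n C suc n) * f (suc n))
  ≡⟨ cong (λ c → shifted + (binomialSum n f + + c * f (suc n))) (k>n⇒nCk≡0 (ℕₚ.n<1+n n)) ⟩
    shifted + (binomialSum n f + + 0)
  ≡⟨ cong (λ x → shifted + x) (ℤₚ.+-identityʳ (binomialSum n f)) ⟩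
    shifted + binomialSum n f
  ≡⟨ ℤₚ.+-comm shifted (binomialSum n f) ⟩
    binomialSum n f + shifted
  ≡⟨ sym (sumBelow-+ (suc n) (λ j → + (n C j) * f j) (λ j → + (n C j) * f (suc j))) ⟩
    sumBelow (suc n) (λ j → + (n C j) * f j + + (n C j) * f (suc j))
  ≡⟨ sumBelow-cong (suc n) (λ j → sym (ℤₚ.*-distribˡ-+ (+ (n C j)) (f j) (f (suc j)))) ⟩
    binomialSum n (λ j → f j + f (suc j))
  ∎
  where
  shifted : ℤ
  shifted = sumBelow (suc n) (λ j → + (n C j) * f (suc j))

binomialSum-powers-suc : ∀ c n (g : ℕ → ℤ) →
  binomialSum (suc n) (λ j → c ^ j * g j) ≡ binomialSum n (λ j → c ^ j * (g j + c * g (suc j)))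
binomialSum-powers-suc c n g =
  trans (binomialSum-suc n (λ j → c ^ j * g j))
        (binomialSum-cong n (λ j → factor (c ^ j) c (g j) (g (suc j))))
  where
  factor : ∀ p c x y → p * x + c * p * y ≡ p * (x + c * y)
  factor = solve-∀

binomialSum-2^ : ∀ n {g} → FibLike g → binomialSum n (λ j → (+ 2) ^ j * g j) ≡ g (3 ℕ.* n)
binomialSum-2^ zero {g} g-fib = trans (binomialSum-zero (λ j → (+ 2) ^ j * g j)) (ℤₚ.*-identityˡ (g 0))
binomialSum-2^ (suc n) {g} g-fib@(fibLike g-rec) = begin
    binomialSum (suc n) (λ j → (+ 2) ^ j * g j)
  ≡⟨ binomialSum-powers-suc (+ 2) n g ⟩
    binomialSum n (λ j → (+ 2) ^ j * (g j + + 2 * g (suc j)))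
  ≡⟨ binomialSum-cong n (λ j → cong ((+ 2) ^ j *_) (FibLike-2-step g-fib j)) ⟩
    binomialSum n (λ j → (+ 2) ^ j * g (3 ℕ.+ j))
  ≡⟨ binomialSum-2^ n (fibLike λ j → g-rec (3 ℕ.+ j)) ⟩
    g (3 ℕ.+ 3 ℕ.* n)
  ≡⟨ cong g (sym (ℕₚ.*-suc 3 n)) ⟩
    g (3 ℕ.* suc n)
  ∎

binomialSum-[-2]^-even : ∀ m {g} → FibLike g →
  binomialSum (2 ℕ.* m) (λ j → (- + 2) ^ j * g j) ≡ (+ 5) ^ m * g 0
binomialSum-[-2]^-even zero {g} g-fib = binomialSum-zero (λ j → (- + 2) ^ j * g j)
binomialSum-[-2]^-even (suc m) {g} g-fib = begin
    binomialSum (2 ℕ.* suc m) (λ j → (- + 2) ^ j * g j)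
  ≡⟨ cong (λ k → binomialSum k (λ j → (- + 2) ^ j * g j)) (ℕₚ.*-suc 2 m) ⟩
    binomialSum (suc (suc (2 ℕ.* m))) (λ j → (- + 2) ^ j * g j)
  ≡⟨ binomialSum-powers-suc (- + 2) (suc (2 ℕ.* m)) g ⟩
    binomialSum (suc (2 ℕ.* m)) (λ j → (- + 2) ^ j * Δ g j)
  ≡⟨ binomialSum-powers-suc (- + 2) (2 ℕ.* m) (Δ g) ⟩
    binomialSum (2 ℕ.* m) (λ j → (- + 2) ^ j * Δ (Δ g) j)
  ≡⟨ binomialSum-[-2]^-even m (FibLike-Δ (FibLike-Δ g-fib)) ⟩
    (+ 5) ^ m * Δ (Δ g) 0
  ≡⟨ cong ((+ 5) ^ m *_) (Δ-Δ g-fib 0) ⟩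
    (+ 5) ^ m * (+ 5 * g 0)
  ≡⟨ reassociate ((+ 5) ^ m) (g 0) ⟩
    (+ 5) ^ suc m * g 0
  ∎
  where
  reassociate : ∀ p x → p * (+ 5 * x) ≡ + 5 * p * x
  reassociate = solve-∀

binomialSum-[-2]^-odd : ∀ m {g} → FibLike g →
  binomialSum (suc (2 ℕ.* m)) (λ j → (- + 2) ^ j * g j) ≡ (+ 5) ^ m * Δ g 0
binomialSum-[-2]^-odd m {g} g-fib =
  trans (binomialSum-powers-suc (- + 2) (2 ℕ.* m) g) (binomialSum-[-2]^-even m (FibLike-Δ g-fib))

ceilHalf-2+ : ∀ n → ceilHalf (2 ℕ.+ n) ≡ suc (ceilHalf n)
ceilHalf-2+ n =
  trans (cong (2 ℕ.+ n ℕ.∸_) (m/n≡1+[m∸n]/n {2 ℕ.+ n} {2} (ℕ.s≤s (ℕ.s≤s ℕ.z≤n))))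
        (ℕₚ.+-∸-assoc 1 (m/n≤m n 2))

ceilHalf-2* : ∀ m → ceilHalf (2 ℕ.* m) ≡ m
ceilHalf-2* zero = refl
ceilHalf-2* (suc m) =
  trans (cong ceilHalf (ℕₚ.*-suc 2 m)) (trans (ceilHalf-2+ (2 ℕ.* m)) (cong suc (ceilHalf-2* m)))

ceilHalf-2*+1 : ∀ m → ceilHalf (2 ℕ.* m ℕ.+ 1) ≡ suc m
ceilHalf-2*+1 zero = refl
ceilHalf-2*+1 (suc m) =
  trans (cong (λ k → ceilHalf (k ℕ.+ 1)) (ℕₚ.*-suc 2 m))
        (trans (ceilHalf-2+ (2 ℕ.* m ℕ.+ 1)) (cong suc (ceilHalf-2*+1 m)))

square-^ : ∀ i k → i ^ (2 ℕ.* k) ≡ (i * i) ^ k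
square-^ i k = trans (sym (ℤₚ.^-*-assoc i 2 k)) (cong (λ x → (i * x) ^ k) (ℤₚ.*-identityʳ i))

module OddBinomialSum {G : ℤ → ℤ} (G-fib : FibLikeℤ G) (s : ℤ) where

  g : ℕ → ℤ
  g j = G (+ suc j + s)

  g-fib : FibLike g
  g-fib = FibLike-∘suc (FibLikeℤ⇒FibLike G-fib s)

  term : ℕ → ℕ → ℤ
  term n k = + (n C (2 ℕ.* k ℕ.∸ 1)) * ((+ 4) ^ k) * G (+ (2 ℕ.* k) + s)

  oddPart : ℕ → ℕ → ℤ
  oddPart n j = + (n C j) * ((+ 2) ^ j * g j - (- + 2) ^ j * g j)

  oddPart-even : ∀ n k → oddPart n (2 ℕ.* k) ≡ + 0
  oddPart-even n k = begin
      + (n C (2 ℕ.* k)) * ((+ 2) ^ (2 ℕ.* k) * x - (- + 2) ^ (2 ℕ.* k) * x)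
    ≡⟨ cong₂ (λ a b → + (n C (2 ℕ.* k)) * (a * x - b * x)) (square-^ (+ 2) k) (square-^ (- + 2) k) ⟩
      + (n C (2 ℕ.* k)) * ((+ 4) ^ k * x - (+ 4) ^ k * x)
    ≡⟨ cong (+ (n C (2 ℕ.* k)) *_) (ℤₚ.+-inverseʳ ((+ 4) ^ k * x)) ⟩
      + (n C (2 ℕ.* k)) * + 0
    ≡⟨ ℤₚ.*-zeroʳ (+ (n C (2 ℕ.* k))) ⟩
      + 0
    ∎
    where
    x : ℤ
    x = g (2 ℕ.* k)

  term-odd : ∀ n k → term n (suc k) ≡ oddPart n (suc (2 ℕ.* k))
  term-odd n k = begin
      term n (suc k)
    ≡⟨ cong (λ i → + (n C (i ℕ.∸ 1)) * (+ 4) ^ suc k * G (+ i + s)) (ℕₚ.*-suc 2 k) ⟩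
      c * (+ 4 * (+ 4) ^ k) * x
    ≡⟨ split-4 c ((+ 4) ^ k) x ⟩
      c * (+ 2 * (+ 4) ^ k * x - - + 2 * (+ 4) ^ k * x)
    ≡⟨ cong₂ (λ a b → c * (+ 2 * a * x - - + 2 * b * x)) (sym (square-^ (+ 2) k)) (sym (square-^ (- + 2) k)) ⟩
      oddPart n (suc (2 ℕ.* k))
    ∎
    where
    c x : ℤ
    c = + (n C suc (2 ℕ.* k))
    x = g (suc (2 ℕ.* k))
    split-4 : ∀ c p x → c * (+ 4 * p) * x ≡ c * (+ 2 * p * x - - + 2 * p * x)
    split-4 = solve-∀

  sumBelow-oddPart : ∀ n → sumBelow (suc n) (oddPart n) ≡ g (3 ℕ.* n) - binomialSum n (λ j → (- + 2) ^ j * g j)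
  sumBelow-oddPart n = begin
      sumBelow (suc n) (oddPart n)
    ≡⟨ sumBelow-cong (suc n) (λ j → distrib (+ (n C j)) ((+ 2) ^ j * g j) ((- + 2) ^ j * g j)) ⟩
      sumBelow (suc n) (λ j → + (n C j) * ((+ 2) ^ j * g j) - + (n C j) * ((- + 2) ^ j * g j))
    ≡⟨ sumBelow-- (suc n) _ _ ⟩
      binomialSum n (λ j → (+ 2) ^ j * g j) - binomialSum n (λ j → (- + 2) ^ j * g j)
    ≡⟨ cong (_- binomialSum n (λ j → (- + 2) ^ j * g j)) (binomialSum-2^ n g-fib) ⟩
      g (3 ℕ.* n) - binomialSum n (λ j → (- + 2) ^ j * g j)
    ∎
    where
    distrib : ∀ c a b → c * (a - b) ≡ c * a - c * b
    distrib = solve-∀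

  evenCase : ∀ m → sumFrom1 (ceilHalf (2 ℕ.* m)) (term (2 ℕ.* m))
                   ≡ G (+ (3 ℕ.* (2 ℕ.* m) ℕ.+ 1) + s) - (+ 5) ^ m * G (s + + 1)
  evenCase m = begin
      sumFrom1 (ceilHalf n) (term n)
    ≡⟨ cong (λ K → sumFrom1 K (term n)) (ceilHalf-2* m) ⟩
      sumFrom1 m (term n)
    ≡⟨ sumFrom1≡sumBelow-2* m (oddPart-even n) (term-odd n) ⟩
      sumBelow n (oddPart n)
    ≡⟨ sym (sumBelow-suc-0 n (oddPart n) (oddPart-even n m)) ⟩
      sumBelow (suc n) (oddPart n)
    ≡⟨ sumBelow-oddPart n ⟩
      g (3 ℕ.* n) - binomialSum n (λ j → (- + 2) ^ j * g j)
    ≡⟨ cong (λ y → g (3 ℕ.* n) - y) (binomialSum-[-2]^-even m g-fib) ⟩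
      g (3 ℕ.* n) - (+ 5) ^ m * g 0
    ≡⟨ cong₂ (λ i t → G (+ i + s) - (+ 5) ^ m * G t) (ℕₚ.+-comm 1 (3 ℕ.* n)) (ℤₚ.+-comm (+ 1) s) ⟩
      G (+ (3 ℕ.* n ℕ.+ 1) + s) - (+ 5) ^ m * G (s + + 1)
    ∎
    where
    n : ℕ
    n = 2 ℕ.* m

  oddCase : ∀ m {H : ℤ → ℤ} → (∀ t → G t + - + 2 * G (sucℤ t) ≡ - H t) →
            sumFrom1 (ceilHalf (2 ℕ.* m ℕ.+ 1)) (term (2 ℕ.* m ℕ.+ 1))
              ≡ G (+ (3 ℕ.* (2 ℕ.* m ℕ.+ 1) ℕ.+ 1) + s) + (+ 5) ^ m * H (s + + 1)
  oddCase m {H} ΔG≡-H = begin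
      sumFrom1 (ceilHalf n) (term n)
    ≡⟨ cong (λ K → sumFrom1 K (term n)) (ceilHalf-2*+1 m) ⟩
      sumFrom1 (suc m) (term n)
    ≡⟨ sumFrom1≡sumBelow-2* (suc m) (oddPart-even n) (term-odd n) ⟩
      sumBelow (2 ℕ.* suc m) (oddPart n)
    ≡⟨ cong (λ N → sumBelow N (oddPart n)) (trans (ℕₚ.*-suc 2 m) (cong suc (sym n≡1+2m))) ⟩
      sumBelow (suc n) (oddPart n)
    ≡⟨ sumBelow-oddPart n ⟩
      g (3 ℕ.* n) - binomialSum n (λ j → (- + 2) ^ j * g j)
    ≡⟨ cong (λ k → g (3 ℕ.* n) - binomialSum k (λ j → (- + 2) ^ j * g j)) n≡1+2m ⟩
      g (3 ℕ.* n) - binomialSum (suc (2 ℕ.* m)) (λ j → (- + 2) ^ j * g j)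
    ≡⟨ cong (λ y → g (3 ℕ.* n) - y) (binomialSum-[-2]^-odd m g-fib) ⟩
      g (3 ℕ.* n) - (+ 5) ^ m * (G (+ 1 + s) + - + 2 * G (+ 2 + s))
    ≡⟨ cong (λ t → g (3 ℕ.* n) - (+ 5) ^ m * (G (+ 1 + s) + - + 2 * G t)) (ℤₚ.suc-+ 1 s) ⟩
      g (3 ℕ.* n) - (+ 5) ^ m * (G (+ 1 + s) + - + 2 * G (sucℤ (+ 1 + s)))
    ≡⟨ cong₂ (λ i t → G (+ i + s) - (+ 5) ^ m * (G t + - + 2 * G (sucℤ t)))
             (ℕₚ.+-comm 1 (3 ℕ.* n)) (ℤₚ.+-comm (+ 1) s) ⟩
      G (+ (3 ℕ.* n ℕ.+ 1) + s) - (+ 5) ^ m * (G (s + + 1) + - + 2 * G (sucℤ (s + + 1)))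
    ≡⟨ cong (λ y → G (+ (3 ℕ.* n ℕ.+ 1) + s) - (+ 5) ^ m * y) (ΔG≡-H (s + + 1)) ⟩
      G (+ (3 ℕ.* n ℕ.+ 1) + s) - (+ 5) ^ m * - H (s + + 1)
    ≡⟨ sub-neg (G (+ (3 ℕ.* n ℕ.+ 1) + s)) ((+ 5) ^ m) (H (s + + 1)) ⟩
      G (+ (3 ℕ.* n ℕ.+ 1) + s) + (+ 5) ^ m * H (s + + 1)
    ∎
    where
    n : ℕ
    n = 2 ℕ.* m ℕ.+ 1
    n≡1+2m : n ≡ suc (2 ℕ.* m)
    n≡1+2m = ℕₚ.+-comm (2 ℕ.* m) 1
    sub-neg : ∀ x p y → x - p * - y ≡ x + p * y
    sub-neg = solve-∀

open OddBinomialSum using (evenCase; oddCase)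

theorem20 : (n : ℕ) (s : ℤ) →
    ((m : ℕ) → n ≡ 2 ℕ.* m →
      (sumFrom1 (ceilHalf n) (λ k → + (n C (2 ℕ.* k ℕ.∸ 1)) * ((+ 4) ^ k) * F (+ (2 ℕ.* k) + s))
        ≡ F (+ (3 ℕ.* n ℕ.+ 1) + s) - ((+ 5) ^ m) * F (s + + 1))
      × (sumFrom1 (ceilHalf n) (λ k → + (n C (2 ℕ.* k ℕ.∸ 1)) * ((+ 4) ^ k) * L (+ (2 ℕ.* k) + s))
        ≡ L (+ (3 ℕ.* n ℕ.+ 1) + s) - ((+ 5) ^ m) * L (s + + 1)))
    × ((m : ℕ) → n ≡ 2 ℕ.* m ℕ.+ 1 →
      (sumFrom1 (ceilHalf n) (λ k → + (n C (2 ℕ.* k ℕ.∸ 1)) * ((+ 4) ^ k) * F (+ (2 ℕ.* k) + s))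
        ≡ F (+ (3 ℕ.* n ℕ.+ 1) + s) + ((+ 5) ^ m) * L (s + + 1))
      × (sumFrom1 (ceilHalf n) (λ k → + (n C (2 ℕ.* k ℕ.∸ 1)) * ((+ 4) ^ k) * L (+ (2 ℕ.* k) + s))
        ≡ L (+ (3 ℕ.* n ℕ.+ 1) + s) + ((+ 5) ^ (m ℕ.+ 1)) * F (s + + 1)))
theorem20 n s =
    (λ { m refl → evenCase F-fibLike s m , evenCase L-fibLike s m })
  , (λ { m refl → oddCase F-fibLike s m F-Δ
                , trans (oddCase L-fibLike s m L-Δ)
                        (cong (λ y → L (+ (3 ℕ.* n ℕ.+ 1) + s) + y) (5^m*[5*x] m (F (s + + 1)))) })
  where
  5^m*[5*x] : ∀ m x → (+ 5) ^ m * (+ 5 * x) ≡ (+ 5) ^ (m ℕ.+ 1) * x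
  5^m*[5*x] m x =
    trans (sym (ℤₚ.*-assoc ((+ 5) ^ m) (+ 5) x)) (cong (_* x) (sym (ℤₚ.^-distribˡ-+-* (+ 5) m 1)))
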